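{- Let $A,B\subseteq\mathbb{Z}$ be finite nonempty sets with $|A|,|B|\ge 2$ and $B\subsetneq A$. Then $|A\widehat{+}B|\ge |A|+|B|-2$.
   Context: For finite sets $A,B\subseteq\mathbb{Z}$, the restricted sumset is $A\widehat{+}B=\{a+b: a\in A,\ b\in B,\ a\neq b\}$. -}

module Defs where

open import Data.Integer using (ℤ; _+_; _≟_)
open import Data.List using (List; []; _∷_; concatMap; filter; map; deduplicate; length)
open import Data.List.Membership.Propositional using (_∈_)
open import Data.List.Relation.Unary.Unique.Propositional using (Unique)
open import Data.Product using (_×_)
open import Relation.Nullary using (¬_)
open import Relation.Nullary.Decidable using (¬?)

restrictedSumset : List ℤ → List ℤ → List ℤ
restrictedSumset A B =
  deduplicate _≟_ (concatMap (λ a → map (λ b → a + b) (filter (λ b → ¬? (a ≟ b)) B)) A)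

-- Finite subset of ℤ represented by a duplicate-free list; cardinality = length.
-- Subset relation on such lists.
_⊆ₗ_ : List ℤ → List ℤ → Set
X ⊆ₗ Y = ∀ {x} → x ∈ X → x ∈ Y

_⊂ₗ_ : List ℤ → List ℤ → Set
X ⊂ₗ Y = X ⊆ₗ Y × ¬ (Y ⊆ₗ X)

module Submission where

-- Enumerate A increasingly and read B as a decidable predicate on it; we build a strictly
-- increasing (hence duplicate-free) list of restricted sums by induction on the least element t.
-- Every restricted sum of the tail is at least a₀ + a₁, its two smallest elements, so
-- t + a₀ < t + a₁ are new; they are restricted sums whenever t ∈ B, or a₀, a₁ ∈ B. If t ∉ B
-- but the tail still meets the complement of B, only t + min B is needed, as |B| does not
-- grow. The induction ends when B = {t}, where the sums t + a with a in the tail suffice, or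
-- when the tail is exactly B, where the same pairing argument gives |B ∔ B| ≥ 2|B| − 3.

open import Defs
open import Data.Integer using (ℤ; _<_; _≟_) renaming (_+_ to _+ℤ_; _≤_ to _≤ℤ_)
open import Data.Integer.Properties
  using ( ≤-refl; <⇒≤; <⇒≢; ≤∧≢⇒<; <-trans; <-≤-trans; +-comm; +-monoʳ-<; +-monoˡ-<
        ; +-mono-≤; +-monoʳ-≤; +-mono-<-≤; ≤-decTotalOrder; ≤-totalOrder)
open import Data.Nat using (suc; z≤n; s≤s; _≤_; _+_; _∸_)
open import Data.Nat.Properties as ℕ using (module ≤-Reasoning)
open import Data.List using (List; []; _∷_; _++_; length; map; filter)
open import Data.List.Properties using (length-map; filter-all; filter-none)
open import Data.List.Relation.Unary.All as All using (All; []; _∷_; all?)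
open import Data.List.Relation.Unary.All.Properties using (¬Any⇒All¬; ¬All⇒Any¬; ++⁺; map⁺)
open import Data.List.Relation.Unary.Any using (Any; here; there; any?)
open import Data.List.Relation.Unary.AllPairs as AllPairs using (AllPairs; []; _∷_)
import Data.List.Relation.Unary.AllPairs.Properties as AllPairs
open import Data.List.Relation.Unary.Unique.Propositional using (Unique)
import Data.List.Relation.Unary.Unique.Propositional.Properties as Unique
open import Data.List.Relation.Unary.Unique.DecPropositional.Properties _≟_ using (deduplicate-!)
open import Data.List.Relation.Unary.Sorted.TotalOrder.Properties using (Sorted⇒AllPairs)
open import Data.List.Membership.Propositional using (_∈_; lose)
open import Data.List.Membership.Propositional.Properties
  using (∈-deduplicate⁺; ∈-concatMap⁺; ∈-map⁺; ∈-filter⁺)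
open import Data.List.Membership.DecPropositional _≟_ using (_∈?_)
open import Data.List.Relation.Binary.Permutation.Propositional using (_↭_; ↭-sym; ↭⇒↭ₛ)
open import Data.List.Relation.Binary.Permutation.Propositional.Properties
  using (∈-resp-↭; ↭-length)
open import Data.List.Relation.Binary.Permutation.Setoid.Properties using (Unique-resp-↭)
import Data.List.Sort as Sort
open import Data.List.Fresh as Fresh using (fromList)
import Data.List.Fresh.Relation.Unary.Any as Fresh
import Data.List.Fresh.Membership.Setoid as FreshMembership
open import Data.List.Fresh.Membership.Setoid.Properties using (injection)
open import Data.Product using (Σ; ∃; _×_; _,_; proj₁; proj₂)
open import Data.Empty using (⊥-elim)
open import Function using (id; _∘_)
open import Relation.Nullary using (yes; no)
open import Relation.Nullary.Decidable using (¬?)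
open import Relation.Unary using (Pred; Decidable; ∁)
open import Relation.Binary.PropositionalEquality
  using (_≡_; _≢_; refl; sym; trans; cong; subst; subst₂; setoid)

open FreshMembership (setoid ℤ) using () renaming (_∈_ to _∈#_)

private
  variable
    t u x y a₀ a₁ : ℤ
    xs ys as : List ℤ

length-fromList : (xs! : Unique xs) → Fresh.length (fromList xs!) ≡ length xs
length-fromList []        = refl
length-fromList (_ ∷ xs!) = cong suc (length-fromList xs!)

∈-fromList⁺ : (xs! : Unique xs) → x ∈ xs → x ∈# fromList xs!
∈-fromList⁺ (_ ∷ _)   (here x≡)  = Fresh.here x≡
∈-fromList⁺ (_ ∷ xs!) (there x∈) = Fresh.there (∈-fromList⁺ xs! x∈)

∈-fromList⁻ : (xs! : Unique xs) → x ∈# fromList xs! → x ∈ xs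
∈-fromList⁻ (_ ∷ _)   (Fresh.here x≡)  = here x≡
∈-fromList⁻ (_ ∷ xs!) (Fresh.there x∈) = there (∈-fromList⁻ xs! x∈)

unique-⊆⇒length-≤ : Unique xs → Unique ys → (∀ {x} → x ∈ xs → x ∈ ys) → length xs ≤ length ys
unique-⊆⇒length-≤ xs! ys! xs⊆ys =
  subst₂ _≤_ (length-fromList xs!) (length-fromList ys!)
    (injection (setoid ℤ) id (∈-fromList⁺ ys! ∘ xs⊆ys ∘ ∈-fromList⁻ xs!))

suc+suc-mono : ∀ m n {k} → m + n ≤ k → suc m + suc n ≤ suc (suc k)
suc+suc-mono m n m+n≤k rewrite ℕ.+-suc m n = s≤s (s≤s m+n≤k)

open Sort ≤-decTotalOrder using (sort; sort-↭; sort-↗)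

strictlySorted : Unique xs → ∃ λ ys → ys ↭ xs × AllPairs _<_ ys
strictlySorted {xs} xs! =
  sort xs , sort-↭ xs , AllPairs.zipWith (λ (x≤y , x≢y) → ≤∧≢⇒< x≤y x≢y) (sorted , sorted!)
  where
  sorted : AllPairs _≤ℤ_ (sort xs)
  sorted = Sorted⇒AllPairs ≤-totalOrder (sort-↗ xs)
  sorted! : Unique (sort xs)
  sorted! = Unique-resp-↭ (setoid ℤ) (↭⇒↭ₛ (↭-sym (sort-↭ xs))) xs!

head<∈ : AllPairs _<_ (x ∷ xs) → y ∈ xs → x < y
head<∈ ↑ = All.lookup (AllPairs.head ↑)

head≤ : AllPairs _<_ (x ∷ xs) → y ∈ x ∷ xs → x ≤ℤ y
head≤ _           (here refl) = ≤-refl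
head≤ ↑           (there y∈)  = <⇒≤ (head<∈ ↑ y∈)

second≤ : AllPairs _<_ (a₀ ∷ a₁ ∷ as) → y ∈ a₀ ∷ a₁ ∷ as → y ≢ a₀ → a₁ ≤ℤ y
second≤ _        (here refl) y≢a₀ = ⊥-elim (y≢a₀ refl)
second≤ (_ ∷ ↑)  (there y∈)  _    = head≤ ↑ y∈

leastSatisfying : ∀ {p} {P : Pred ℤ p} → Decidable P → AllPairs _<_ xs → Any P xs →
                  ∃ λ b₀ → b₀ ∈ xs × P b₀ × (∀ {b} → b ∈ xs → P b → b₀ ≤ℤ b)
leastSatisfying {x ∷ xs} P? ↑ some with P? x
... | yes Px = x , here refl , Px , λ b∈ _ → head≤ ↑ b∈
leastSatisfying {x ∷ xs} P? (_ ∷ ↑) (here Px)    | no ¬Px = ⊥-elim (¬Px Px)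
leastSatisfying {x ∷ xs} P? (_ ∷ ↑) (there some) | no ¬Px
  with b₀ , b₀∈ , Pb₀ , least ← leastSatisfying P? ↑ some =
  b₀ , there b₀∈ , Pb₀ , λ { (here refl) Px → ⊥-elim (¬Px Px) ; (there b∈) Pb → least b∈ Pb }

module RestrictedSums {p} {P : Pred ℤ p} (P? : Decidable P) where

  data RestrictedSum (A : List ℤ) : ℤ → Set p where
    restrictedSum : ∀ {a b} → a ∈ A → b ∈ A → P b → a ≢ b → RestrictedSum A (a +ℤ b)

  weaken : RestrictedSum xs x → RestrictedSum (t ∷ xs) x
  weaken (restrictedSum a∈ b∈ Pb a≢b) = restrictedSum (there a∈) (there b∈) Pb a≢b

  BelowSums : List ℤ → ℤ → Set p
  BelowSums A u = ∀ {x} → RestrictedSum A x → u < x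

  sum≥twoSmallest : AllPairs _<_ (a₀ ∷ a₁ ∷ as) → RestrictedSum (a₀ ∷ a₁ ∷ as) x → a₀ +ℤ a₁ ≤ℤ x
  sum≥twoSmallest {a₀} {a₁} ↑ (restrictedSum {a} {b} a∈ b∈ _ a≢b) with a ≟ a₀
  ... | yes refl = +-monoʳ-≤ a₀ (second≤ ↑ b∈ (a≢b ∘ sym))
  ... | no a≢a₀  = subst (a₀ +ℤ a₁ ≤ℤ_) (+-comm b a) (+-mono-≤ (head≤ ↑ b∈) (second≤ ↑ a∈ a≢a₀))

  sumWithHeadInB : AllPairs _<_ (t ∷ xs) → P t → y ∈ xs → RestrictedSum (t ∷ xs) (t +ℤ y)
  sumWithHeadInB {t} {y = y} ↑ Pt y∈ =
    subst (RestrictedSum _) (+-comm y t)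
          (restrictedSum (there y∈) (here refl) Pt (<⇒≢ (head<∈ ↑ y∈) ∘ sym))

  sumWithTailInB : AllPairs _<_ (t ∷ xs) → y ∈ xs → P y → RestrictedSum (t ∷ xs) (t +ℤ y)
  sumWithTailInB ↑ y∈ Py = restrictedSum (here refl) (there y∈) Py (<⇒≢ (head<∈ ↑ y∈))

  record IncreasingSums (A : List ℤ) : Set p where
    field
      sums       : List ℤ
      increasing : AllPairs _<_ sums
      restricted : All (RestrictedSum A) sums
  open IncreasingSums public

  noSums : IncreasingSums xs
  noSums = record { sums = [] ; increasing = [] ; restricted = [] }

  oneSum : RestrictedSum xs u → IncreasingSums xs
  oneSum s = record { sums = _ ∷ [] ; increasing = [] ∷ [] ; restricted = s ∷ [] }

  prepend : (us : List ℤ) → AllPairs _<_ us → All (RestrictedSum (t ∷ xs)) us →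
            All (BelowSums xs) us → IncreasingSums xs → IncreasingSums (t ∷ xs)
  prepend us us↑ us-sums us-below r = record
    { sums       = us ++ sums r
    ; increasing = AllPairs.++⁺ us↑ (increasing r)
                     (All.map {P = BelowSums _} (λ below → All.map below (restricted r)) us-below)
    ; restricted = ++⁺ us-sums (All.map weaken (restricted r))
    }

  prependPair : AllPairs _<_ (t ∷ a₀ ∷ a₁ ∷ as) →
                RestrictedSum (t ∷ a₀ ∷ a₁ ∷ as) (t +ℤ a₀) →
                RestrictedSum (t ∷ a₀ ∷ a₁ ∷ as) (t +ℤ a₁) →
                IncreasingSums (a₀ ∷ a₁ ∷ as) → IncreasingSums (t ∷ a₀ ∷ a₁ ∷ as)
  prependPair {t} {a₀} {a₁} {as} ↑ s₀ s₁ =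
    prepend _ ((t+a₀<t+a₁ ∷ []) ∷ [] ∷ []) (s₀ ∷ s₁ ∷ [])
            ((<-trans t+a₀<t+a₁ ∘ t+a₁<sums) ∷ t+a₁<sums ∷ [])
    where
    t+a₀<t+a₁ : t +ℤ a₀ < t +ℤ a₁
    t+a₀<t+a₁ = +-monoʳ-< t (head<∈ (AllPairs.tail ↑) (here refl))
    t+a₁<sums : BelowSums (a₀ ∷ a₁ ∷ as) (t +ℤ a₁)
    t+a₁<sums s =
      <-≤-trans (+-monoˡ-< a₁ (head<∈ ↑ (here refl))) (sum≥twoSmallest (AllPairs.tail ↑) s)

  fullSubsetSums : AllPairs _<_ xs → All P xs →
                   Σ (IncreasingSums xs) λ r → length xs + length xs ≤ length (sums r) + 3
  fullSubsetSums {[]}         _ _              = noSums , z≤n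
  fullSubsetSums {_ ∷ []}     _ _              = noSums , s≤s (s≤s z≤n)
  fullSubsetSums {_ ∷ _ ∷ []} ↑ (_ ∷ Pa₀ ∷ []) =
    oneSum (sumWithTailInB ↑ (here refl) Pa₀) , ℕ.≤-refl
  fullSubsetSums {_ ∷ xs@(_ ∷ _ ∷ _)} ↑ (_ ∷ Ptail@(Pa₀ ∷ Pa₁ ∷ _)) =
    let r , bound = fullSubsetSums (AllPairs.tail ↑) Ptail in
    prependPair ↑ (sumWithTailInB ↑ (here refl) Pa₀) (sumWithTailInB ↑ (there (here refl)) Pa₁) r ,
    suc+suc-mono (length xs) (length xs) bound

  headPlusTailSums : AllPairs _<_ (t ∷ xs) → P t →
                     Σ (IncreasingSums (t ∷ xs)) λ r → length (sums r) ≡ length xs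
  headPlusTailSums {t} {xs} ↑ Pt =
    record { sums       = map (t +ℤ_) xs
           ; increasing = AllPairs.map⁺ (AllPairs.map (+-monoʳ-< t) (AllPairs.tail ↑))
           ; restricted = map⁺ (All.tabulate (sumWithHeadInB ↑ Pt)) }
    , length-map (t +ℤ_) xs

  onlyHeadOutsideSums : AllPairs _<_ (t ∷ xs) → All P xs → Any P xs →
                        Σ (IncreasingSums (t ∷ xs)) λ r →
                          suc (length xs) + length xs ≤ length (sums r) + 2
  onlyHeadOutsideSums {xs = _ ∷ []} ↑ (Pb₀ ∷ []) _ =
    oneSum (sumWithTailInB ↑ (here refl) Pb₀) , ℕ.≤-refl
  onlyHeadOutsideSums {xs = xs@(_ ∷ _ ∷ _)} ↑ Pxs@(Pb₀ ∷ Pb₁ ∷ _) _ =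
    let r , bound = fullSubsetSums (AllPairs.tail ↑) Pxs in
    prependPair ↑ (sumWithTailInB ↑ (here refl) Pb₀) (sumWithTailInB ↑ (there (here refl)) Pb₁) r ,
    s≤s (subst (length xs + length xs ≤_) (ℕ.+-suc (length (sums r)) 2) bound)

  properSubsetSums : AllPairs _<_ xs → Any (∁ P) xs → Any P xs →
                     Σ (IncreasingSums xs) λ r →
                       length xs + length (filter P? xs) ≤ length (sums r) + 2
  properSubsetSums {t ∷ xs} ↑ outside inside with P? t
  properSubsetSums {t ∷ xs} _ (here ¬Pt) _ | yes Pt = ⊥-elim (¬Pt Pt)
  properSubsetSums {t ∷ xs} ↑ (there outside) _ | yes Pt with any? P? xs
  ... | no noneInB rewrite filter-none P? (¬Any⇒All¬ xs noneInB) =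
    let r , |r|≡|xs| = headPlusTailSums ↑ Pt in
    r , ℕ.≤-reflexive (trans (sym (ℕ.+-suc (length xs) 1)) (cong (_+ 2) (sym |r|≡|xs|)))
  properSubsetSums {t ∷ _ ∷ []} _ (there (here ¬Pa)) _ | yes Pt | yes (here Pa) = ⊥-elim (¬Pa Pa)
  properSubsetSums {t ∷ xs@(_ ∷ _ ∷ _)} ↑ (there outside) _ | yes Pt | yes inside =
    let r , bound = properSubsetSums (AllPairs.tail ↑) outside inside in
    prependPair ↑ (sumWithHeadInB ↑ Pt (here refl)) (sumWithHeadInB ↑ Pt (there (here refl))) r ,
    suc+suc-mono (length xs) (length (filter P? xs)) bound
  properSubsetSums {t ∷ xs} _ _ (here Pt) | no ¬Pt = ⊥-elim (¬Pt Pt)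
  properSubsetSums {t ∷ xs} ↑ _ (there inside) | no ¬Pt with all? P? xs
  ... | yes allInB rewrite filter-all P? allInB = onlyHeadOutsideSums ↑ allInB inside
  ... | no notAllInB =
    let r , bound = properSubsetSums (AllPairs.tail ↑) (¬All⇒Any¬ P? xs notAllInB) inside
        b₀ , b₀∈ , Pb₀ , least = leastSatisfying P? (AllPairs.tail ↑) inside
        t+b₀<sums : BelowSums xs (t +ℤ b₀)
        t+b₀<sums = λ { (restrictedSum a∈ b∈ Pb _) → +-mono-<-≤ (head<∈ ↑ a∈) (least b∈ Pb) }
    in prepend _ ([] ∷ []) (sumWithTailInB ↑ b₀∈ Pb₀ ∷ []) (t+b₀<sums ∷ []) r , s≤s bound

∈-restrictedSumset : ∀ {A B a b} → a ∈ A → b ∈ B → a ≢ b → a +ℤ b ∈ restrictedSumset A B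
∈-restrictedSumset {B = B} {a} a∈A b∈B a≢b =
  ∈-deduplicate⁺ _≟_ (∈-concatMap⁺ (λ a → map (a +ℤ_) (filter (¬? ∘ (a ≟_)) B))
    (lose a∈A (∈-map⁺ (a +ℤ_) (∈-filter⁺ (¬? ∘ (a ≟_)) b∈B a≢b))))

lemma5 : (A B : List ℤ) → Unique A → Unique B →
    2 ≤ length A → 2 ≤ length B → B ⊂ₗ A →
    length A + length B ∸ 2 ≤ length (restrictedSumset A B)
lemma5 A B@(_ ∷ _) A! B! _ _ (B⊆A , A⊈B) with sA , sA↭A , sA↑ ← strictlySorted A! = begin
  length A + length B ∸ 2                     ≤⟨ ℕ.∸-monoˡ-≤ 2 (ℕ.+-mono-≤ |A|≤ |B|≤) ⟩
  length sA + length (filter (_∈? B) sA) ∸ 2  ≤⟨ ℕ.∸-monoˡ-≤ 2 bound ⟩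
  length (sums r) + 2 ∸ 2                     ≡⟨ ℕ.m+n∸n≡m _ 2 ⟩
  length (sums r)                             ≤⟨ |sums|≤ ⟩
  length (restrictedSumset A B)               ∎
  where
  open ≤-Reasoning
  open RestrictedSums (_∈? B)

  toA : x ∈ sA → x ∈ A
  toA = ∈-resp-↭ sA↭A
  toS : x ∈ A → x ∈ sA
  toS = ∈-resp-↭ (↭-sym sA↭A)

  |A|≤ : length A ≤ length sA
  |A|≤ = ℕ.≤-reflexive (sym (↭-length sA↭A))

  |B|≤ : length B ≤ length (filter (_∈? B) sA)
  |B|≤ = unique-⊆⇒length-≤ B! (Unique.filter⁺ (_∈? B) (AllPairs.map <⇒≢ sA↑))
           (λ b∈B → ∈-filter⁺ (_∈? B) (toS (B⊆A b∈B)) b∈B)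

  inside : Any (_∈ B) sA
  inside = lose (toS (B⊆A (here refl))) (here refl)

  outside : Any (∁ (_∈ B)) sA
  outside = ¬All⇒Any¬ (_∈? B) sA (λ sA⊆B → A⊈B (All.lookup sA⊆B ∘ toS))

  r : IncreasingSums sA
  r = proj₁ (properSubsetSums sA↑ outside inside)
  bound : length sA + length (filter (_∈? B) sA) ≤ length (sums r) + 2
  bound = proj₂ (properSubsetSums sA↑ outside inside)

  sums⊆ : x ∈ sums r → x ∈ restrictedSumset A B
  sums⊆ x∈ with restrictedSum a∈ _ b∈B a≢b ← All.lookup (restricted r) x∈ =
    ∈-restrictedSumset (toA a∈) b∈B a≢b

  |sums|≤ : length (sums r) ≤ length (restrictedSumset A B)
  |sums|≤ = unique-⊆⇒length-≤ (AllPairs.map <⇒≢ (increasing r)) (deduplicate-! _) sums⊆
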